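{- Let $p$ be a prime and $n\geq 1$. Then for every $j\in\{0,\dots,p^n-1\}$, the values $\widetilde{\mathcal{G}}_{p,n}(ip^n+j)$ form a complete system of residues modulo $p$ when $i$ runs through a complete system of residues modulo $p$.
   Context: For a prime $p$: $\widetilde{\mathcal{G}}_{p,0}(x)=x$ and $\widetilde{\mathcal{G}}_{p,n}(x)=\frac{1}{p}\prod_{i=0}^{p-1}\left(\widetilde{\mathcal{G}}_{p,n-1}(x)-i\right)$ for $n\geq 1$; these rational polynomials take integer values at all integers. -}

module Defs where

open import Data.Nat using (ℕ; zero; suc; _^_)
open import Data.Nat.Primality using (Prime; prime⇒nonZero)
open import Data.Integer using (ℤ; +_; _-_)
open import Data.Integer.Divisibility using (_∣_)
open import Data.Rational using (ℚ; _/_; _*_; 1ℚ)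
import Data.Rational as ℚ
open import Data.Fin using (Fin)
open import Relation.Binary.PropositionalEquality using (_≡_)

ℤ→ℚ : ℤ → ℚ
ℤ→ℚ z = z / 1

fallingProd : ℕ → ℚ → ℚ
fallingProd zero    y = 1ℚ
fallingProd (suc k) y = fallingProd k y * (y ℚ.- ℤ→ℚ (+ k))

G̃ : (p : ℕ) → Prime p → ℕ → ℚ → ℚ
G̃ p pp zero    x = x
G̃ p pp (suc n) x = ((+ 1) / p) {{prime⇒nonZero pp}} * fallingProd p (G̃ p pp n x)

CompleteResidueSystem : (p : ℕ) → (Fin p → ℤ) → Set
CompleteResidueSystem p f = ∀ k l → (+ p) ∣ (f k - f l) → k ≡ l

-- For an integer y the falling factorial (y)_p = y(y − 1)⋯(y − p + 1) is divisible by p,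
-- and G̃_{p,n} is the n-th iterate of G(y) = (y)_p / p on the integers.  If p ∣ d then
-- (y + d)_p = (y)_p + d·c, where modulo p the cofactor c is the derivative of (y)_p: of
-- its p terms only the one omitting the unique factor y − i divisible by p survives, so
-- p ∤ c.  Hence G(y + e p) = G(y) + e c, and by induction on m,
-- G^m(x + t p^(m+k)) ≡ G^m(x) + u t p^k (mod p^(k+1)) for some u prime to p.  For k = 0
-- this says G^n(x + t p^n) − G^n(x) ≡ u t (mod p), so i ↦ G^n(i p^n + j) keeps distinct
-- residues distinct.
module Submission where

open import Defs
open import Data.Nat using (ℕ; _^_; _≥_; _<_)
open import Data.Nat.Primality using (Prime)
open import Data.Integer using (ℤ; +_; _+_; _*_)
open import Data.Fin using (Fin)
open import Data.Product using (Σ; _×_)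
open import Relation.Binary.PropositionalEquality using (_≡_)

import Data.Nat as ℕ
import Data.Nat.Properties as ℕP
import Data.Nat.Divisibility as ℕD
import Data.Nat.Coprimality as Coprimality
open import Data.Nat.Primality using (euclidsLemma; prime⇒nonZero; prime⇒nonTrivial)
open import Data.Integer using (-_; _-_; ∣_∣; -[1+_]; 0ℤ; 1ℤ)
import Data.Integer as ℤ
import Data.Integer.Properties as ℤP
open import Data.Integer.Divisibility.Signed
  using (_∣_; divides; ∣-refl; ∣ᵤ⇒∣; ∣⇒∣ᵤ; ∣m∣n⇒∣m+n; ∣m∣n⇒∣m-n; ∣m+n∣m⇒∣n; ∣m+n∣n⇒∣m; ∣n⇒∣m*n; ∣m⇒∣m*n)
open import Data.Integer.DivMod using (_%ℕ_; _/ℕ_; n%ℕd<d; a≡a%ℕn+[a/ℕn]*n)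
open import Data.Integer.Tactic.RingSolver using (solve-∀)
open import Data.Rational using (mkℚ)
import Data.Rational as ℚ
import Data.Rational.Properties as ℚP
open import Data.Product using (_,_)
open import Data.Sum using (_⊎_; inj₁; inj₂)
open import Relation.Nullary using (¬_; contradiction)
open import Relation.Binary.PropositionalEquality using (refl; sym; trans; cong; cong₂; subst; module ≡-Reasoning)

fallingℤ : ℕ → ℤ → ℤ
fallingℤ ℕ.zero    y = 1ℤ
fallingℤ (ℕ.suc k) y = fallingℤ k y * (y - + k)

fallingDiff : ℤ → ℤ → ℕ → ℤ
fallingDiff y d ℕ.zero    = 0ℤ
fallingDiff y d (ℕ.suc k) = fallingℤ k y + fallingDiff y d k * (y - + k + d)

falling-+ : ∀ y d k → fallingℤ k (y + d) ≡ fallingℤ k y + d * fallingDiff y d k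
falling-+ y d ℕ.zero    = 1≡1+d*0 d
  where
  1≡1+d*0 : ∀ d → 1ℤ ≡ 1ℤ + d * 0ℤ
  1≡1+d*0 = solve-∀
falling-+ y d (ℕ.suc k) = trans (cong (_* (y + d - + k)) (falling-+ y d k))
                                (expand (fallingℤ k y) (fallingDiff y d k) d y (+ k))
  where
  expand : ∀ f c d y k → (f + d * c) * (y + d - k) ≡ f * (y - k) + d * (f + c * (y - k + d))
  expand = solve-∀

coprimeTo-1 : ∀ n → Coprimality.Coprime n 1
coprimeTo-1 n = Coprimality.sym (Coprimality.1-coprimeTo n)

ℤ→ℚ≡mkℚ : ∀ z → ℤ→ℚ z ≡ mkℚ z 0 (coprimeTo-1 ∣ z ∣)
ℤ→ℚ≡mkℚ z = ℚP.↥p/↧p≡p (mkℚ z 0 _)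

ℤ→ℚ-* : ∀ a b → ℤ→ℚ a ℚ.* ℤ→ℚ b ≡ ℤ→ℚ (a * b)
ℤ→ℚ-* a b = cong₂ ℚ._*_ (ℤ→ℚ≡mkℚ a) (ℤ→ℚ≡mkℚ b)

ℤ→ℚ-+ : ∀ a b → ℤ→ℚ a ℚ.+ ℤ→ℚ b ≡ ℤ→ℚ (a + b)
ℤ→ℚ-+ a b = trans (cong₂ ℚ._+_ (ℤ→ℚ≡mkℚ a) (ℤ→ℚ≡mkℚ b)) (cong (ℚ._/ 1) (a*1+b*1≡a+b a b))
  where
  a*1+b*1≡a+b : ∀ a b → a * 1ℤ + b * 1ℤ ≡ a + b
  a*1+b*1≡a+b = solve-∀

ℤ→ℚ-neg : ∀ a → ℚ.- ℤ→ℚ a ≡ ℤ→ℚ (- a)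
ℤ→ℚ-neg a = trans (cong ℚ.-_ (ℤ→ℚ≡mkℚ a)) (trans (neg-mkℚ a) (sym (ℤ→ℚ≡mkℚ (- a))))
  where
  neg-mkℚ : ∀ a → ℚ.- mkℚ a 0 (coprimeTo-1 ∣ a ∣) ≡ mkℚ (- a) 0 (coprimeTo-1 ∣ - a ∣)
  neg-mkℚ (+ ℕ.zero)            = refl
  neg-mkℚ (+ ℕ.suc _)           = refl
  neg-mkℚ -[1+ _ ]             = refl

ℤ→ℚ-- : ∀ a b → ℤ→ℚ a ℚ.- ℤ→ℚ b ≡ ℤ→ℚ (a - b)
ℤ→ℚ-- a b = trans (cong (ℤ→ℚ a ℚ.+_) (ℤ→ℚ-neg b)) (ℤ→ℚ-+ a (- b))

fallingProd-ℤ→ℚ : ∀ k a → fallingProd k (ℤ→ℚ a) ≡ ℤ→ℚ (fallingℤ k a)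
fallingProd-ℤ→ℚ ℕ.zero    a = refl
fallingProd-ℤ→ℚ (ℕ.suc k) a =
  trans (cong₂ ℚ._*_ (fallingProd-ℤ→ℚ k a) (ℤ→ℚ-- a (+ k))) (ℤ→ℚ-* (fallingℤ k a) (a - + k))

1/n*n≡1 : ∀ n .{{_ : ℕ.NonZero n}} → (+ 1 ℚ./ n) ℚ.* ℤ→ℚ (+ n) ≡ ℚ.1ℚ
1/n*n≡1 (ℕ.suc n) =
  trans (cong₂ ℚ._*_ (ℚP.normalize-coprime (Coprimality.1-coprimeTo (ℕ.suc n))) (ℤ→ℚ≡mkℚ (+ ℕ.suc n)))
        (ℚP.*-inverseˡ (mkℚ (+ ℕ.suc n) 0 (coprimeTo-1 (ℕ.suc n))))

1/n*[a*n]≡a : ∀ n .{{_ : ℕ.NonZero n}} a → (+ 1 ℚ./ n) ℚ.* ℤ→ℚ (a * + n) ≡ ℤ→ℚ a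
1/n*[a*n]≡a n a = begin
  n⁻¹ ℚ.* ℤ→ℚ (a * + n)           ≡⟨ cong (n⁻¹ ℚ.*_) (sym (ℤ→ℚ-* a (+ n))) ⟩
  n⁻¹ ℚ.* (ℤ→ℚ a ℚ.* ℤ→ℚ (+ n))   ≡⟨ sym (ℚP.*-assoc n⁻¹ (ℤ→ℚ a) (ℤ→ℚ (+ n))) ⟩
  (n⁻¹ ℚ.* ℤ→ℚ a) ℚ.* ℤ→ℚ (+ n)   ≡⟨ cong (ℚ._* ℤ→ℚ (+ n)) (ℚP.*-comm n⁻¹ (ℤ→ℚ a)) ⟩
  (ℤ→ℚ a ℚ.* n⁻¹) ℚ.* ℤ→ℚ (+ n)   ≡⟨ ℚP.*-assoc (ℤ→ℚ a) n⁻¹ (ℤ→ℚ (+ n)) ⟩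
  ℤ→ℚ a ℚ.* (n⁻¹ ℚ.* ℤ→ℚ (+ n))   ≡⟨ cong (ℤ→ℚ a ℚ.*_) (1/n*n≡1 n) ⟩
  ℤ→ℚ a ℚ.* ℚ.1ℚ                  ≡⟨ ℚP.*-identityʳ (ℤ→ℚ a) ⟩
  ℤ→ℚ a                           ∎
  where
  open ≡-Reasoning
  n⁻¹ = + 1 ℚ./ n

∣∧<⇒≡0 : ∀ {m n} → m ℕD.∣ n → n < m → n ≡ 0
∣∧<⇒≡0 {n = ℕ.zero}  _   _   = refl
∣∧<⇒≡0 {n = ℕ.suc _} m∣n n<m = contradiction m∣n (ℕD.>⇒∤ n<m)

module ModuloPrime (p : ℕ) (pp : Prime p) where

  instance
    p≢0 : ℕ.NonZero p
    p≢0 = prime⇒nonZero pp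

  P : ℤ
  P = + p

  euclidsLemmaℤ : ∀ a b → P ∣ a * b → (P ∣ a) ⊎ (P ∣ b)
  euclidsLemmaℤ a b P∣ab
    with euclidsLemma ∣ a ∣ ∣ b ∣ pp (subst (p ℕD.∣_) (ℤP.abs-* a b) (∣⇒∣ᵤ P∣ab))
  ... | inj₁ p∣a = inj₁ (∣ᵤ⇒∣ p∣a)
  ... | inj₂ p∣b = inj₂ (∣ᵤ⇒∣ p∣b)

  ∤-* : ∀ {a b} → ¬ P ∣ a → ¬ P ∣ b → ¬ P ∣ a * b
  ∤-* {a} {b} P∤a P∤b P∣ab with euclidsLemmaℤ a b P∣ab
  ... | inj₁ P∣a = P∤a P∣a
  ... | inj₂ P∣b = P∤b P∣b

  ∣*∤⇒∣ : ∀ {a b} → P ∣ a * b → ¬ P ∣ a → P ∣ b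
  ∣*∤⇒∣ {a} {b} P∣ab P∤a with euclidsLemmaℤ a b P∣ab
  ... | inj₁ P∣a = contradiction P∣a P∤a
  ... | inj₂ P∣b = P∣b

  ∣+∤⇒∤ : ∀ {a b} → P ∣ a → ¬ P ∣ b → ¬ P ∣ a + b
  ∣+∤⇒∤ P∣a P∤b P∣a+b = P∤b (∣m+n∣m⇒∣n P∣a+b P∣a)

  ∤+∣⇒∤ : ∀ {a b} → ¬ P ∣ a → P ∣ b → ¬ P ∣ a + b
  ∤+∣⇒∤ P∤a P∣b P∣a+b = P∤a (∣m+n∣n⇒∣m P∣a+b P∣b)

  ∤1 : ¬ P ∣ 1ℤ
  ∤1 P∣1 = ℕ.nonTrivial⇒≢1 {{prime⇒nonTrivial pp}} (ℕD.∣1⇒≡1 (∣⇒∣ᵤ P∣1))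

  +[p^n]≡P^n : ∀ n → + (p ℕ.^ n) ≡ P ℤ.^ n
  +[p^n]≡P^n ℕ.zero    = refl
  +[p^n]≡P^n (ℕ.suc n) = trans (ℤP.pos-* p (p ℕ.^ n)) (cong (P *_) (+[p^n]≡P^n n))

  residue : ℤ → ℕ
  residue y = y %ℕ p

  residue<p : ∀ y → residue y < p
  residue<p y = n%ℕd<d y p

  ∣y-residue : ∀ y → P ∣ y - + residue y
  ∣y-residue y = divides (y /ℕ p) (begin
    y - + residue y                      ≡⟨ cong (_- + residue y) (a≡a%ℕn+[a/ℕn]*n y p) ⟩
    + residue y + (y /ℕ p) * P - + residue y ≡⟨ [r+qP]-r≡qP (+ residue y) (y /ℕ p) P ⟩
    (y /ℕ p) * P                         ∎)
    where
    open ≡-Reasoning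
    [r+qP]-r≡qP : ∀ r q P → r + q * P - r ≡ q * P
    [r+qP]-r≡qP = solve-∀

  ∣[+a-+b]⇒a≡b : ∀ {a b} → a < p → b < p → P ∣ + a - + b → a ≡ b
  ∣[+a-+b]⇒a≡b {a} {b} a<p b<p P∣a-b = ℤP.+-injective (ℤP.i-j≡0⇒i≡j (+ a) (+ b)
    (ℤP.∣i∣≡0⇒i≡0 (∣∧<⇒≡0 (∣⇒∣ᵤ P∣a-b) ∣a-b∣<p)))
    where
    ∣a-b∣<p : ∣ + a - + b ∣ < p
    ∣a-b∣<p = ℕP.≤-<-trans
      (subst (ℕ._≤ a ℕ.⊔ b) (cong ∣_∣ (sym (ℤP.[+m]-[+n]≡m⊖n a b))) (ℤP.∣m⊝n∣≤m⊔n a b))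
      (ℕP.⊔-lub a<p b<p)

  residue-unique : ∀ {y k} → k < p → P ∣ y - + k → k ≡ residue y
  residue-unique {y} {k} k<p P∣y-k = ∣[+a-+b]⇒a≡b k<p (residue<p y)
    (subst (P ∣_) ([y-r]-[y-k]≡k-r y (+ k) (+ residue y)) (∣m∣n⇒∣m-n (∣y-residue y) P∣y-k))
    where
    [y-r]-[y-k]≡k-r : ∀ y k r → (y - r) - (y - k) ≡ k - r
    [y-r]-[y-k]≡k-r = solve-∀

  ∤[y-k] : ∀ y {k} → k < p → ¬ k ≡ residue y → ¬ P ∣ y - + k
  ∤[y-k] y k<p k≢r P∣y-k = k≢r (residue-unique {y} k<p P∣y-k)

  ∤[y-k+d] : ∀ y {k d} → k < p → ¬ k ≡ residue y → P ∣ d → ¬ P ∣ y - + k + d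
  ∤[y-k+d] y k<p k≢r P∣d P∣y-k+d = ∤[y-k] y k<p k≢r (∣m+n∣n⇒∣m P∣y-k+d P∣d)

  falling-∤ : ∀ y k → k ℕ.≤ residue y → ¬ P ∣ fallingℤ k y
  falling-∤ y ℕ.zero    _   = ∤1
  falling-∤ y (ℕ.suc k) k<r =
    ∤-* (falling-∤ y k (ℕP.<⇒≤ k<r)) (∤[y-k] y (ℕP.<-trans k<r (residue<p y)) (ℕP.<⇒≢ k<r))

  falling-∣ : ∀ y k → residue y < k → P ∣ fallingℤ k y
  falling-∣ y ℕ.zero    ()
  falling-∣ y (ℕ.suc k) r<1+k with ℕP.m<1+n⇒m<n∨m≡n r<1+k
  ... | inj₁ r<k = ∣m⇒∣m*n (y - + k) (falling-∣ y k r<k)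
  ... | inj₂ r≡k = ∣n⇒∣m*n (fallingℤ k y) (subst (λ i → P ∣ y - + i) r≡k (∣y-residue y))

  fallingDiff-∤ : ∀ y {d} k → P ∣ d → residue y < k → k ℕ.≤ p → ¬ P ∣ fallingDiff y d k
  fallingDiff-∤ y ℕ.zero    _ () _
  fallingDiff-∤ y {d} (ℕ.suc k) P∣d r<1+k 1+k≤p with ℕP.m<1+n⇒m<n∨m≡n r<1+k
  ... | inj₁ r<k = ∣+∤⇒∤ (falling-∣ y k r<k)
    (∤-* (fallingDiff-∤ y k P∣d r<k (ℕP.<⇒≤ 1+k≤p)) (∤[y-k+d] y 1+k≤p (λ k≡r → ℕP.<⇒≢ r<k (sym k≡r)) P∣d))
  ... | inj₂ r≡k = ∤+∣⇒∤ (falling-∤ y k (ℕP.≤-reflexive (sym r≡k)))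
    (∣n⇒∣m*n (fallingDiff y d k) (∣m∣n⇒∣m+n (subst (λ i → P ∣ y - + i) r≡k (∣y-residue y)) P∣d))

  G₁ : ℤ → ℤ
  G₁ y = _∣_.quotient (falling-∣ y p (residue<p y))

  falling≡G₁*P : ∀ y → fallingℤ p y ≡ G₁ y * P
  falling≡G₁*P y = _∣_.equality (falling-∣ y p (residue<p y))

  G₁-shift : ∀ y e → Σ ℤ λ c → ¬ P ∣ c × G₁ (y + e * P) ≡ G₁ y + e * c
  G₁-shift y e = c , fallingDiff-∤ y p (divides e refl) (residue<p y) ℕP.≤-refl
               , ℤP.*-cancelʳ-≡ (G₁ (y + e * P)) (G₁ y + e * c) P (begin
    G₁ (y + e * P) * P           ≡⟨ sym (falling≡G₁*P (y + e * P)) ⟩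
    fallingℤ p (y + e * P)       ≡⟨ falling-+ y (e * P) p ⟩
    fallingℤ p y + e * P * c     ≡⟨ cong (_+ e * P * c) (falling≡G₁*P y) ⟩
    G₁ y * P + e * P * c         ≡⟨ factor (G₁ y) e c P ⟩
    (G₁ y + e * c) * P           ∎)
    where
    open ≡-Reasoning
    c = fallingDiff y (e * P) p
    factor : ∀ g e c P → g * P + e * P * c ≡ (g + e * c) * P
    factor = solve-∀

  Gℤ : ℕ → ℤ → ℤ
  Gℤ ℕ.zero    x = x
  Gℤ (ℕ.suc n) x = G₁ (Gℤ n x)

  G̃≡Gℤ : ∀ n z → G̃ p pp n (ℤ→ℚ z) ≡ ℤ→ℚ (Gℤ n z)
  G̃≡Gℤ ℕ.zero    z = refl
  G̃≡Gℤ (ℕ.suc n) z = begin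
    p⁻¹ ℚ.* fallingProd p (G̃ p pp n (ℤ→ℚ z)) ≡⟨ cong (λ w → p⁻¹ ℚ.* fallingProd p w) (G̃≡Gℤ n z) ⟩
    p⁻¹ ℚ.* fallingProd p (ℤ→ℚ (Gℤ n z))     ≡⟨ cong (p⁻¹ ℚ.*_) (fallingProd-ℤ→ℚ p (Gℤ n z)) ⟩
    p⁻¹ ℚ.* ℤ→ℚ (fallingℤ p (Gℤ n z))        ≡⟨ cong (λ w → p⁻¹ ℚ.* ℤ→ℚ w) (falling≡G₁*P (Gℤ n z)) ⟩
    p⁻¹ ℚ.* ℤ→ℚ (G₁ (Gℤ n z) * P)            ≡⟨ 1/n*[a*n]≡a p (G₁ (Gℤ n z)) ⟩
    ℤ→ℚ (G₁ (Gℤ n z))                        ∎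
    where
    open ≡-Reasoning
    p⁻¹ = + 1 ℚ./ p

  Gℤ-shift : ∀ m k x t → Σ ℤ λ u → Σ ℤ λ s → ¬ P ∣ u ×
    Gℤ m (x + t * P ℤ.^ (m ℕ.+ k)) ≡ Gℤ m x + u * t * P ℤ.^ k + s * P ℤ.^ ℕ.suc k
  Gℤ-shift ℕ.zero k x t = 1ℤ , 0ℤ , ∤1 , pad x t (P ℤ.^ k) (P ℤ.^ ℕ.suc k)
    where
    pad : ∀ x t a b → x + t * a ≡ x + 1ℤ * t * a + 0ℤ * b
    pad = solve-∀
  Gℤ-shift (ℕ.suc m) k x t with Gℤ-shift m (ℕ.suc k) x t
  ... | u , s , P∤u , eq with G₁-shift (Gℤ m x) (u * t * P ℤ.^ k + s * P * P ℤ.^ k)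
  ...   | c , P∤c , G₁-eq = u * c , s * c , ∤-* P∤u P∤c , (begin
    G₁ (Gℤ m (x + t * P ℤ.^ ℕ.suc (m ℕ.+ k)))
      ≡⟨ cong (λ i → G₁ (Gℤ m (x + t * P ℤ.^ i))) (sym (ℕP.+-suc m k)) ⟩
    G₁ (Gℤ m (x + t * P ℤ.^ (m ℕ.+ ℕ.suc k)))
      ≡⟨ cong G₁ eq ⟩
    G₁ (y + u * t * (P * q) + s * (P * (P * q)))
      ≡⟨ cong G₁ (collect y u t s P q) ⟩
    G₁ (y + (u * t * q + s * P * q) * P)
      ≡⟨ G₁-eq ⟩
    G₁ y + (u * t * q + s * P * q) * c
      ≡⟨ distribute (G₁ y) u t s P q c ⟩
    G₁ y + u * c * t * q + s * c * (P * q) ∎)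
    where
    open ≡-Reasoning
    y = Gℤ m x
    q = P ℤ.^ k
    collect : ∀ y u t s P q → y + u * t * (P * q) + s * (P * (P * q)) ≡ y + (u * t * q + s * P * q) * P
    collect = solve-∀
    distribute : ∀ g u t s P q c → g + (u * t * q + s * P * q) * c ≡ g + u * c * t * q + s * c * (P * q)
    distribute = solve-∀

  ∣ΔGℤ⇒∣t : ∀ n x t → P ∣ Gℤ n (x + t * P ℤ.^ n) - Gℤ n x → P ∣ t
  ∣ΔGℤ⇒∣t n x t P∣Δ with Gℤ-shift n 0 x t
  ... | u , s , P∤u , eq = ∣*∤⇒∣ (∣m+n∣n⇒∣m (subst (P ∣_) Δ≡ut+sP P∣Δ) (∣n⇒∣m*n s ∣-refl)) P∤u
    where
    open ≡-Reasoning
    cancel : ∀ g a b P → g + a * 1ℤ + b * (P * 1ℤ) - g ≡ a + b * P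
    cancel = solve-∀
    Δ≡ut+sP : Gℤ n (x + t * P ℤ.^ n) - Gℤ n x ≡ u * t + s * P
    Δ≡ut+sP = begin
      Gℤ n (x + t * P ℤ.^ n) - Gℤ n x
        ≡⟨ cong (λ i → Gℤ n (x + t * P ℤ.^ i) - Gℤ n x) (sym (ℕP.+-identityʳ n)) ⟩
      Gℤ n (x + t * P ℤ.^ (n ℕ.+ 0)) - Gℤ n x
        ≡⟨ cong (_- Gℤ n x) eq ⟩
      Gℤ n x + u * t * 1ℤ + s * (P * 1ℤ) - Gℤ n x
        ≡⟨ cancel (Gℤ n x) (u * t) s P ⟩
      u * t + s * P ∎

mainTheorem17 : (p : ℕ) (pp : Prime p) (n : ℕ) → n ≥ 1 → (j : ℕ) → j < p ^ n →
    (i : Fin p → ℤ) → CompleteResidueSystem p i →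
    Σ (Fin p → ℤ) (λ g →
      (∀ k → G̃ p pp n (ℤ→ℚ (i k * + (p ^ n) + + j)) ≡ ℤ→ℚ (g k))
      × CompleteResidueSystem p g)
mainTheorem17 p pp n _ j _ i i-complete = g , (λ k → G̃≡Gℤ n (x k)) , g-complete
  where
  open ModuloPrime p pp
  x : Fin p → ℤ
  x k = i k * + (p ^ n) + + j
  g : Fin p → ℤ
  g k = Gℤ n (x k)
  x-shift : ∀ k l → x k ≡ x l + (i k - i l) * P ℤ.^ n
  x-shift k l = trans (rearrange (i k) (i l) (+ (p ^ n)) (+ j)) (cong (λ q → x l + (i k - i l) * q) (+[p^n]≡P^n n))
    where
    rearrange : ∀ a b q j → a * q + j ≡ b * q + j + (a - b) * q
    rearrange = solve-∀
  g-complete : CompleteResidueSystem p g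
  g-complete k l p∣gk-gl = i-complete k l (∣⇒∣ᵤ (∣ΔGℤ⇒∣t n (x l) (i k - i l)
    (subst (λ z → P ∣ Gℤ n z - g l) (x-shift k l) (∣ᵤ⇒∣ p∣gk-gl))))
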